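{- Let $\sigma$ be a partition of a positive integer $r$ with smallest part $\delta$, let $n,q$ be positive integers, let $H=H(n,r,q\mid\sigma)$, and let $\beta$ be an integer with $2 \le s(\sigma)\le\beta$ and $\delta \geq r-\beta + 1$. Suppose we are given a $(2,\beta)$-colouring of $H$, let $V$ be a class of $H$, and let $x\neq y$ be two colours occurring in $V$ that do not occur in any other class of $H$. Let $z$ be a colour not used in the given colouring. If every vertex of $V$ coloured $x$ or $y$ is recoloured $z$ (all other vertices keeping their colours), then the resulting colouring of $H$ is a $(2,\beta)$-colouring.
   Context: For a partition $\sigma$ of $r$ and positive integers $n,q$, the $\sigma$-hypergraph $H(n,r,q\mid\sigma)$ is the $r$-uniform hypergraph whose vertex set has $nq$ vertices partitioned into $n$ classes $V_1,\dots,V_n$ of $q$ vertices each, and in which an $r$-subset $K$ of the vertex set is an edge if and only if the multiset of non-zero cardinalities $|K\cap V_i|$, $1\le i\le n$, is exactly the partition $\sigma$. $s(\sigma)$ denotes the number of parts of $\sigma$ and $\delta$ its smallest part. A $(2,\beta)$-colouring is an assignment of colours to the vertices such that every edge contains at least $2$ and at most $\beta$ distinct colours. -}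

module Defs where

open import Data.Nat using (ℕ; _≤_; _+_; _≟_)
open import Data.Nat.Properties using ()
open import Data.Bool using (Bool; true; false; if_then_else_)
open import Data.Fin using (Fin)
open import Data.Fin.Properties using () renaming (_≟_ to _≟ᶠ_)
open import Data.Nat.ListAction using (sum)
open import Data.List using (List; []; _∷_; length; filter; map; concatMap; deduplicate; allFin)
open import Data.List.Relation.Unary.All using (All)
open import Data.List.Relation.Binary.Permutation.Propositional using (_↭_)
open import Data.Product using (_×_; _,_)
open import Relation.Nullary using (¬_)
open import Relation.Nullary.Decidable using (⌊_⌋)
open import Relation.Unary using (Decidable)
open import Relation.Binary.PropositionalEquality using (_≡_)

-- A partition of r: a list of positive parts summing to r (order irrelevant;
-- partitions are compared as multisets via permutation _↭_).
record IsPartition (r : ℕ) (σ : List ℕ) : Set where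
  field
    parts-pos : All (λ p → 1 ≤ p) σ
    parts-sum : sum σ ≡ r

s : List ℕ → ℕ
s = length

-- Vertices of H(n,r,q|σ): class index i : Fin n, position j : Fin q.
Vertex : ℕ → ℕ → Set
Vertex n q = Fin n × Fin q

VSet : ℕ → ℕ → Set
VSet n q = Fin n → Fin q → Bool

classCount : ∀ {n q} → VSet n q → Fin n → ℕ
classCount {q = q} K i = length (filter (λ j → K i j Data.Bool.≟ true) (allFin q))

nonzero? : Decidable (λ (m : ℕ) → ¬ (m ≡ 0))
nonzero? m = Relation.Nullary.Decidable.¬? (m ≟ 0)

profile : ∀ {n q} → VSet n q → List ℕ
profile {n} K = filter nonzero? (map (classCount K) (allFin n))

IsEdge : (n r q : ℕ) → List ℕ → VSet n q → Set
IsEdge n r q σ K = (sum (map (classCount K) (allFin n)) ≡ r) × (profile K ↭ σ)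

Colouring : ℕ → ℕ → Set
Colouring n q = Vertex n q → ℕ

coloursOf : ∀ {n q} → Colouring n q → VSet n q → List ℕ
coloursOf {n} {q} c K =
  concatMap (λ i → map (λ j → c (i , j)) (filter (λ j → K i j Data.Bool.≟ true) (allFin q))) (allFin n)

numColours : ∀ {n q} → Colouring n q → VSet n q → ℕ
numColours c K = length (deduplicate _≟_ (coloursOf c K))

Is2βColouring : (n r q : ℕ) → List ℕ → ℕ → Colouring n q → Set
Is2βColouring n r q σ β c =
  (K : VSet n q) → IsEdge n r q σ K → (2 ≤ numColours c K) × (numColours c K ≤ β)

recolour : ∀ {n q} → Colouring n q → Fin n → ℕ → ℕ → ℕ → Colouring n q
recolour c V x y z (i , j) =
  if ⌊ i ≟ᶠ V ⌋ Data.Bool.∧ (⌊ c (i , j) ≟ x ⌋ Data.Bool.∨ ⌊ c (i , j) ≟ y ⌋) then z else c (i , j)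

-- Outside V the colours x and y do not occur, so the recolouring is the colouring followed by
-- the map on colours sending x and y to z and fixing everything else.  Applying a map to the
-- colours can only decrease the number of distinct colours on an edge, which gives the upper
-- bound.  For the lower bound, s(σ) ≥ 2 forces every edge to meet a class other than V; the
-- colour b of such a vertex is kept and differs from the fresh colour z.  So either the edge
-- keeps all its colours, or it now carries both z and b.
module Submission where

open import Defs
open import Data.Nat using (ℕ; _≤_; _+_; _≟_; z≤n; s≤s)
open import Data.Nat.Properties using (≤-trans; ≤-reflexive; ≤⇒≯; module ≤-Reasoning)
open import Data.Fin using (Fin)
open import Data.Fin.Properties using (any?) renaming (_≟_ to _≟ᶠ_)
open import Data.Bool using (true; false; _∨_; if_then_else_)
import Data.Bool as Bool
open import Data.List using (List; []; _∷_; length; map; filter; concatMap; deduplicate; allFin)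
open import Data.List.Properties
  using (map-id-local; map-cong; map-∘; length-map; length-removeAt′; concatMap-cong; map-concatMap; filter-none)
open import Data.List.Relation.Unary.All using (All; []; _∷_; all?; tabulate; lookup)
open import Data.List.Relation.Unary.All.Properties using (¬All⇒Any¬)
open import Data.List.Relation.Unary.Any using (here; there; _─_) renaming (map to any-map)
open import Data.List.Relation.Unary.AllPairs using ([]; _∷_)
open import Data.List.Relation.Unary.Unique.Propositional using (Unique)
open import Data.List.Relation.Unary.Unique.Propositional.Properties using (allFin⁺) renaming (filter⁺ to Unique-filter⁺)
import Data.List.Relation.Unary.Unique.DecPropositional.Properties as UniqueDec
open import Data.List.Membership.Propositional using (_∈_; find)
open import Data.List.Membership.Propositional.Properties
  using (∈-map⁺; ∈-map⁻; ∈-filter⁺; ∈-filter⁻; ∈-allFin; ∈-concatMap⁺; ∈-deduplicate⁺; ∈-deduplicate⁻)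
open import Data.List.Relation.Binary.Subset.Propositional using (_⊆_)
open import Data.List.Relation.Binary.Permutation.Propositional.Properties using (↭-length)
open import Data.Product using (∃; _×_; _,_; proj₁; proj₂)
open import Data.Empty using (⊥-elim)
open import Function using (_∘_)
open import Level using (Level)
open import Relation.Nullary using (yes; no; ¬?; does)
open import Relation.Nullary.Decidable using (⌊_⌋; _×-dec_)
open import Relation.Unary using (Pred; Decidable)
open import Relation.Binary using (DecidableEquality)
open import Relation.Binary.PropositionalEquality using (_≡_; _≢_; refl; sym; trans; cong; subst; module ≡-Reasoning)

private
  variable
    a b p : Level
    A : Set a
    B : Set b

∈-─⁺ : ∀ {x y : A} {ys} (x∈ys : x ∈ ys) → y ∈ ys → y ≢ x → y ∈ (ys ─ x∈ys)
∈-─⁺ (here refl) (here refl) y≢x = ⊥-elim (y≢x refl)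
∈-─⁺ (here _)    (there y∈)  _   = y∈
∈-─⁺ (there _)   (here y≡)   _   = here y≡
∈-─⁺ (there x∈)  (there y∈)  y≢x = there (∈-─⁺ x∈ y∈ y≢x)

unique⊆⇒length≤ : ∀ {xs ys : List A} → Unique xs → xs ⊆ ys → length xs ≤ length ys
unique⊆⇒length≤ {xs = []}     _               _   = z≤n
unique⊆⇒length≤ {xs = x ∷ xs} {ys} (x∉xs ∷ !xs) xs⊆ys =
  subst (length (x ∷ xs) ≤_) (sym (length-removeAt′ ys _))
    (s≤s (unique⊆⇒length≤ !xs (λ y∈xs →
      ∈-─⁺ x∈ys (xs⊆ys (there y∈xs)) (λ { refl → lookup x∉xs y∈xs refl }))))
  where
  x∈ys : x ∈ ys
  x∈ys = xs⊆ys (here refl)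

filter-map : ∀ {P : Pred B p} (P? : Decidable P) (f : A → B) xs →
             filter P? (map f xs) ≡ map f (filter (P? ∘ f) xs)
filter-map P? f []       = refl
filter-map P? f (x ∷ xs) with does (P? (f x))
... | true  = cong (f x ∷_) (filter-map P? f xs)
... | false = filter-map P? f xs

module _ (_≟ᴬ_ : DecidableEquality A) where

  2≤length-deduplicate : ∀ {x y xs} → x ∈ xs → y ∈ xs → x ≢ y → 2 ≤ length (deduplicate _≟ᴬ_ xs)
  2≤length-deduplicate x∈ y∈ x≢y = unique⊆⇒length≤ ((x≢y ∷ []) ∷ [] ∷ []) λ
    { (here refl)         → ∈-deduplicate⁺ _≟ᴬ_ x∈
    ; (there (here refl)) → ∈-deduplicate⁺ _≟ᴬ_ y∈
    }

  module _ (_≟ᴮ_ : DecidableEquality B) where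

    length-deduplicate-map≤ : ∀ (f : A → B) xs →
                              length (deduplicate _≟ᴮ_ (map f xs)) ≤ length (deduplicate _≟ᴬ_ xs)
    length-deduplicate-map≤ f xs =
      ≤-trans (unique⊆⇒length≤ (UniqueDec.deduplicate-! _≟ᴮ_ (map f xs)) image⊆)
              (≤-reflexive (length-map f (deduplicate _≟ᴬ_ xs)))
      where
      image⊆ : deduplicate _≟ᴮ_ (map f xs) ⊆ map f (deduplicate _≟ᴬ_ xs)
      image⊆ y∈ with ∈-map⁻ f (∈-deduplicate⁻ _≟ᴮ_ (map f xs) y∈)
      ... | x , x∈ , refl = ∈-map⁺ f (∈-deduplicate⁺ _≟ᴬ_ x∈)

collapse : ℕ → ℕ → ℕ → ℕ → ℕ
collapse x y z w = if ⌊ w ≟ x ⌋ ∨ ⌊ w ≟ y ⌋ then z else w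

collapse-fixes : ∀ {x y z w} → w ≢ x → w ≢ y → collapse x y z w ≡ w
collapse-fixes {x} {y} {z} {w} w≢x w≢y with w ≟ x | w ≟ y
... | yes w≡x | _       = ⊥-elim (w≢x w≡x)
... | no _    | yes w≡y = ⊥-elim (w≢y w≡y)
... | no _    | no _    = refl

collapse-moves-to-z : ∀ {x y z w} → collapse x y z w ≢ w → collapse x y z w ≡ z
collapse-moves-to-z {x} {y} {z} {w} moved with w ≟ x | w ≟ y
... | yes _ | _     = refl
... | no _  | yes _ = refl
... | no _  | no _  = ⊥-elim (moved refl)

2≤length-deduplicate-collapse : ∀ {x y z b} cs → b ∈ cs → b ≢ x → b ≢ y → b ≢ z →
  2 ≤ length (deduplicate _≟_ cs) → 2 ≤ length (deduplicate _≟_ (map (collapse x y z) cs))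
2≤length-deduplicate-collapse {x} {y} {z} {b} cs b∈ b≢x b≢y b≢z 2≤distinct
  with all? (λ w → collapse x y z w ≟ w) cs
... | yes fixed = subst (λ ds → 2 ≤ length (deduplicate _≟_ ds)) (sym (map-id-local fixed)) 2≤distinct
... | no ¬fixed with find (¬All⇒Any¬ (λ w → collapse x y z w ≟ w) cs ¬fixed)
...   | w , w∈ , moved = 2≤length-deduplicate _≟_ z∈ b∈′ (λ z≡b → b≢z (sym z≡b))
  where
  z∈ : z ∈ map (collapse x y z) cs
  z∈ = subst (_∈ _) (collapse-moves-to-z moved) (∈-map⁺ (collapse x y z) w∈)
  b∈′ : b ∈ map (collapse x y z) cs
  b∈′ = subst (_∈ _) (collapse-fixes b≢x b≢y) (∈-map⁺ (collapse x y z) b∈)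

module _ {n q : ℕ} where

  row : VSet n q → Fin n → List (Fin q)
  row K i = filter (λ j → K i j Bool.≟ true) (allFin q)

  recolour≗collapse : ∀ (c : Colouring n q) V {x y} z → (∀ i j → i ≢ V → c (i , j) ≢ x × c (i , j) ≢ y) →
                      ∀ v → recolour c V x y z v ≡ collapse x y z (c v)
  recolour≗collapse c V z absent (i , j) with i ≟ᶠ V
  ... | yes _  = refl
  ... | no i≢V = sym (collapse-fixes (proj₁ (absent i j i≢V)) (proj₂ (absent i j i≢V)))

  coloursOf-map : ∀ {c c′ : Colouring n q} (f : ℕ → ℕ) → (∀ v → c′ v ≡ f (c v)) →
                  ∀ K → coloursOf c′ K ≡ map f (coloursOf c K)
  coloursOf-map {c} {c′} f c′≗f∘c K = begin
    concatMap (λ i → map (λ j → c′ (i , j)) (row K i)) (allFin n)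
      ≡⟨ concatMap-cong (λ i → trans (map-cong (λ j → c′≗f∘c (i , j)) (row K i)) (map-∘ (row K i))) (allFin n) ⟩
    concatMap (λ i → map f (map (λ j → c (i , j)) (row K i))) (allFin n)
      ≡⟨ sym (map-concatMap f (λ i → map (λ j → c (i , j)) (row K i)) (allFin n)) ⟩
    map f (coloursOf c K) ∎
    where open ≡-Reasoning

  ∈-coloursOf⁺ : ∀ (c : Colouring n q) {K i j} → K i j ≡ true → c (i , j) ∈ coloursOf c K
  ∈-coloursOf⁺ c {K} {i} {j} Kij = ∈-concatMap⁺ (λ i → map (λ j → c (i , j)) (row K i))
    (any-map (λ { refl → ∈-map⁺ (λ j → c (i , j)) (∈-filter⁺ (λ j → K i j Bool.≟ true) (∈-allFin j) Kij) })
             (∈-allFin i))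

  classCount≡0 : ∀ (K : VSet n q) i → (∀ j → K i j ≢ true) → classCount K i ≡ 0
  classCount≡0 K i empty =
    cong length (filter-none (λ j → K i j Bool.≟ true) {xs = allFin q} (tabulate λ {j} _ → empty j))

  length-profile≤1 : ∀ (K : VSet n q) V → (∀ i → i ≢ V → classCount K i ≡ 0) → length (profile K) ≤ 1
  length-profile≤1 K V vanishes = begin
    length (profile K)                          ≡⟨ cong length (filter-map nonzero? (classCount K) (allFin n)) ⟩
    length (map (classCount K) occupied)        ≡⟨ length-map (classCount K) occupied ⟩
    length occupied                             ≤⟨ unique⊆⇒length≤ (Unique-filter⁺ _ (allFin⁺ n)) occupied⊆[V] ⟩
    1                                           ∎
    where
    open ≤-Reasoning
    occupied : List (Fin n)
    occupied = filter (nonzero? ∘ classCount K) (allFin n)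
    occupied⊆[V] : occupied ⊆ V ∷ []
    occupied⊆[V] {i} i∈ with i ≟ᶠ V
    ... | yes refl = here refl
    ... | no i≢V   = ⊥-elim (proj₂ (∈-filter⁻ (nonzero? ∘ classCount K) {xs = allFin n} i∈) (vanishes i i≢V))

  edge-leaves-class : ∀ {r σ K} → IsEdge n r q σ K → 2 ≤ s σ →
                      ∀ V → ∃ λ i → i ≢ V × ∃ λ j → K i j ≡ true
  edge-leaves-class {K = K} (_ , profile↭σ) 2≤s V
    with any? (λ i → ¬? (i ≟ᶠ V) ×-dec any? (λ j → K i j Bool.≟ true))
  ... | yes outside = outside
  ... | no ¬outside = ⊥-elim (≤⇒≯ (length-profile≤1 K V vanishes)
                                   (≤-trans 2≤s (≤-reflexive (sym (↭-length profile↭σ)))))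
    where
    vanishes : ∀ i → i ≢ V → classCount K i ≡ 0
    vanishes i i≢V = classCount≡0 K i (λ j Kij → ¬outside (i , i≢V , j , Kij))

lemma4p2 : (r n q β : ℕ) (σ : List ℕ)
    → 1 ≤ r → IsPartition r σ
    → 1 ≤ n → 1 ≤ q
    → 2 ≤ s σ → s σ ≤ β
    → All (λ p → r + 1 ≤ p + β) σ
    → (c : Colouring n q) → Is2βColouring n r q σ β c
    → (V : Fin n) (x y z : ℕ) → x ≢ y
    → (∃ λ j → c (V , j) ≡ x) → (∃ λ j → c (V , j) ≡ y)
    → (∀ i j → i ≢ V → c (i , j) ≢ x × c (i , j) ≢ y)
    → (∀ v → c v ≢ z)
    → Is2βColouring n r q σ β (recolour c V x y z)
lemma4p2 r n q β σ _ _ _ _ 2≤s _ _ c col V x y z _ _ _ absent fresh K edge =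
  subst (2 ≤_) (sym count) at-least-two , subst (_≤ β) (sym count) at-most-β
  where
  cs : List ℕ
  cs = coloursOf c K
  count : numColours (recolour c V x y z) K ≡ length (deduplicate _≟_ (map (collapse x y z) cs))
  count = cong (length ∘ deduplicate _≟_) (coloursOf-map (collapse x y z) (recolour≗collapse c V z absent) K)
  at-most-β : length (deduplicate _≟_ (map (collapse x y z) cs)) ≤ β
  at-most-β = ≤-trans (length-deduplicate-map≤ _≟_ _≟_ (collapse x y z) cs) (proj₂ (col K edge))
  at-least-two : 2 ≤ length (deduplicate _≟_ (map (collapse x y z) cs))
  at-least-two with edge-leaves-class edge 2≤s V
  ... | i , i≢V , j , Kij = 2≤length-deduplicate-collapse cs (∈-coloursOf⁺ c Kij)
                              (proj₁ (absent i j i≢V)) (proj₂ (absent i j i≢V)) (fresh (i , j)) (proj₁ (col K edge))
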